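{- Let $X$ be a set of $v$ points partitioned into four parts $X_0,X_1,X_2,X_3$ whose sizes $v_i=|X_i|$ pairwise differ by at most one, and let $h$ be a positive integer. For $0\le i\le 3$ and $1\le j\le h$ let $(X_i,\mathcal{A}_{i,j})$ be a $(v_i,3,2)$ covering design and $(X_i,\mathcal{B}_{i,j})$ a $(v_i,2,1)$ covering design, such that for each $i$, $\bigcup_{j=1}^h\mathcal{A}_{i,j}$ is the set of all $3$-subsets of $X_i$ and $\bigcup_{j=1}^h\mathcal{B}_{i,j}$ is the set of all $2$-subsets of $X_i$. For $i=0,1$ let $(X_i,\mathcal{D}_i)$ be a $(v_i,5,4,5)$ cover, and for $i=2,3$ let $(X_i,\mathcal{E}_i)$ be a $(v_i,5,4)$ covering design. Define $$\mathcal{C}=\bigcup_{i=0}^{1}\left(\mathcal{D}_i\cup\mathcal{E}_{i+2}\right)\cup\bigcup_{i=0}^{3}\bigcup_{j=1}^{h}\mathcal{A}_{i,j}\mathcal{B}_{(i+1)\bmod 4,\,j}\cup\bigcup_{i=0}^{1}\bigcup_{j=1}^{h}\mathcal{A}_{i,j}\mathcal{B}_{i+2,\,j}.$$ Then $(X,\mathcal{C})$ is a $(v,5,4,6)$ cover.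
   Context: A $(v,k,t,m)$ cover is a pair $(X,\mathcal{B})$ with $|X|=v$ and $\mathcal{B}$ a collection of $k$-subsets of $X$ such that every $m$-subset of $X$ meets some block in at least $t$ points; a $(v,k,t)$ covering design is a $(v,k,t,t)$ cover (every $t$-subset lies in some block). For collections $\mathcal{A},\mathcal{B}$, $\mathcal{A}\mathcal{B}=\{A\cup B: A\in\mathcal{A},B\in\mathcal{B}\}$. -}

module Defs where

open import Data.Nat using (ℕ; _≤_; suc)
open import Data.Fin using (Fin; zero; suc)
open import Data.Fin.Subset using (Subset; _⊆_; _∩_; _∪_; ∣_∣; ⊤; ⊥)
open import Data.Product using (Σ; ∃; ∃-syntax; _×_; _,_)
open import Data.Sum using (_⊎_)
open import Function.Bundles using (_⇔_)
open import Relation.Binary.PropositionalEquality using (_≡_; _≢_)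

-- The point set X is Fin v; a collection of blocks is a predicate on subsets of X.
Coll : ℕ → Set₁
Coll v = Subset v → Set

-- (Y, 𝒞) is a (|Y|, k, t, m) cover, where Y ⊆ X is the ground set:
-- every block is a k-subset of Y, and every m-subset of Y meets some block
-- in at least t points.
IsCover : {v : ℕ} → Subset v → ℕ → ℕ → ℕ → Coll v → Set
IsCover {v} Y k t m 𝒞 =
  (∀ (B : Subset v) → 𝒞 B → B ⊆ Y × ∣ B ∣ ≡ k) ×
  (∀ (S : Subset v) → S ⊆ Y → ∣ S ∣ ≡ m →
     ∃[ B ] (𝒞 B × t ≤ ∣ S ∩ B ∣))

IsCoveringDesign : {v : ℕ} → Subset v → ℕ → ℕ → Coll v → Set
IsCoveringDesign Y k t 𝒞 = IsCover Y k t t 𝒞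

_∪ᶜ_ : {v : ℕ} → Coll v → Coll v → Coll v
(𝒜 ∪ᶜ ℬ) S = 𝒜 S ⊎ ℬ S

_⊗_ : {v : ℕ} → Coll v → Coll v → Coll v
_⊗_ {v} 𝒜 ℬ S = Σ (Subset v) λ A → Σ (Subset v) λ B → 𝒜 A × ℬ B × S ≡ A ∪ B

next4 : Fin 4 → Fin 4
next4 zero = suc zero
next4 (suc zero) = suc (suc zero)
next4 (suc (suc zero)) = suc (suc (suc zero))
next4 (suc (suc (suc zero))) = zero

low : Fin 2 → Fin 4
low zero = zero
low (suc zero) = suc zero

plus2 : Fin 2 → Fin 4
plus2 zero = suc (suc zero)
plus2 (suc zero) = suc (suc (suc zero))

IsPartition4 : {v : ℕ} → (Fin 4 → Subset v) → Set
IsPartition4 P =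
  (∀ i j → i ≢ j → P i ∩ P j ≡ ⊥) ×
  (P zero ∪ P (suc zero) ∪ P (suc (suc zero)) ∪ P (suc (suc (suc zero))) ≡ ⊤)

buildC : {v h : ℕ} → (𝒜 ℬ : Fin 4 → Fin h → Coll v) → (𝒟 ℰ : Fin 2 → Coll v) → Coll v
buildC {v} {h} 𝒜 ℬ 𝒟 ℰ S =
  (∃[ i ] ((𝒟 i ∪ᶜ ℰ i) S)) ⊎
  (∃[ i ] ∃[ j ] (𝒜 i j ⊗ ℬ (next4 i) j) S) ⊎
  (∃[ i ] ∃[ j ] (𝒜 (low i) j ⊗ ℬ (plus2 i) j) S)

module Submission where

-- Let S be a 6-subset of X and c i = |S ∩ X_i| its intersection
-- profile, so c₀ + c₁ + c₂ + c₃ = 6.  Every block family in 𝒞 "serves" a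
-- profile pattern: 𝒟_k a part X_{low k} with c ≥ 5, ℰ_k a part X_{plus2 k}
-- with c ≥ 4, and a product 𝒜_{a,j}ℬ_{b,j} a pair of parts with
-- (c_a, c_b) ≥ (2,2) or ≥ (3,1): pick 2 points of S in X_b (resp. 3 in X_a),
-- use completeness to find the index j whose ℬ_{b,j} (𝒜_{a,j}) contains
-- them, and let the covering design 𝒜_{a,j} (ℬ_{b,j}) catch the rest.
-- The pairs (a,b) used by 𝒞 cover every unordered pair of parts, so
-- (2,2)-profiles are always served; otherwise one part holds all but at
-- most three points and a small arithmetic case analysis finishes.

open import Defs
open import Data.Nat using (ℕ; _≤_; _<_; suc; zero; _+_; z≤n; s≤s; _≤?_)
open import Data.Nat.Properties
  using (+-suc; +-comm; +-assoc; ≤-trans; ≤-reflexive; m≤m+n; n≤1+n;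
         +-mono-≤; +-monoʳ-≤; +-cancelʳ-≤; n≤0⇒n≡0; ≤-pred; ≰⇒>; module ≤-Reasoning)
open import Data.Fin using (Fin; zero; suc; _≟_)
open import Data.Fin.Properties using (any?)
open import Data.Fin.Subset using (Subset; _⊆_; _∈_; ∣_∣; ⊤; ⊥; _∩_; _∪_; inside; outside)
open import Data.Fin.Subset.Properties
  using (⊥⊆; ∣⊥∣≡0; out⊆; in⊆in; ⊆⊤; p⊆q⇒∣p∣≤∣q∣; p∩q⊆p; p∩q⊆q;
         x∈p∩q⁺; x∈p∩q⁻; ∩-distribˡ-∪; ∩-identityʳ)
open import Data.Vec using (_∷_; [])
open import Data.Product using (_×_; ∃-syntax; _,_; proj₁; proj₂)
open import Data.Sum using (_⊎_; inj₁; inj₂)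
open import Function.Bundles using (_⇔_; Equivalence)
open import Relation.Nullary using (yes; no; ¬_; contradiction)
open import Relation.Nullary.Decidable using (¬?; _×-dec_)
open import Relation.Binary.PropositionalEquality
  using (_≡_; _≢_; refl; sym; trans; cong; cong₂; subst; module ≡-Reasoning)

∣p∪q∣+∣p∩q∣ : ∀ {n} (p q : Subset n) → ∣ p ∪ q ∣ + ∣ p ∩ q ∣ ≡ ∣ p ∣ + ∣ q ∣
∣p∪q∣+∣p∩q∣ [] [] = refl
∣p∪q∣+∣p∩q∣ (inside ∷ p) (inside ∷ q) = cong suc (begin
  ∣ p ∪ q ∣ + suc ∣ p ∩ q ∣  ≡⟨ +-suc ∣ p ∪ q ∣ ∣ p ∩ q ∣ ⟩
  suc (∣ p ∪ q ∣ + ∣ p ∩ q ∣) ≡⟨ cong suc (∣p∪q∣+∣p∩q∣ p q) ⟩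
  suc (∣ p ∣ + ∣ q ∣)         ≡⟨ +-suc ∣ p ∣ ∣ q ∣ ⟨
  ∣ p ∣ + suc ∣ q ∣           ∎)
  where open ≡-Reasoning
∣p∪q∣+∣p∩q∣ (inside ∷ p) (outside ∷ q) = cong suc (∣p∪q∣+∣p∩q∣ p q)
∣p∪q∣+∣p∩q∣ (outside ∷ p) (inside ∷ q) =
  trans (cong suc (∣p∪q∣+∣p∩q∣ p q)) (sym (+-suc ∣ p ∣ ∣ q ∣))
∣p∪q∣+∣p∩q∣ (outside ∷ p) (outside ∷ q) = ∣p∪q∣+∣p∩q∣ p q

∣p∪q∣≤∣p∣+∣q∣ : ∀ {n} (p q : Subset n) → ∣ p ∪ q ∣ ≤ ∣ p ∣ + ∣ q ∣
∣p∪q∣≤∣p∣+∣q∣ p q = ≤-trans (m≤m+n ∣ p ∪ q ∣ ∣ p ∩ q ∣) (≤-reflexive (∣p∪q∣+∣p∩q∣ p q))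

∣p∪q∣-disjoint : ∀ {n} (p q : Subset n) → p ∩ q ⊆ ⊥ → ∣ p ∪ q ∣ ≡ ∣ p ∣ + ∣ q ∣
∣p∪q∣-disjoint {n} p q disjoint = begin
  ∣ p ∪ q ∣                 ≡⟨ +-comm 0 ∣ p ∪ q ∣ ⟩
  ∣ p ∪ q ∣ + 0             ≡⟨ cong (∣ p ∪ q ∣ +_) ∣p∩q∣≡0 ⟨
  ∣ p ∪ q ∣ + ∣ p ∩ q ∣     ≡⟨ ∣p∪q∣+∣p∩q∣ p q ⟩
  ∣ p ∣ + ∣ q ∣             ∎
  where
  open ≡-Reasoning
  ∣p∩q∣≡0 : ∣ p ∩ q ∣ ≡ 0
  ∣p∩q∣≡0 = n≤0⇒n≡0 (≤-trans (p⊆q⇒∣p∣≤∣q∣ disjoint) (≤-reflexive (∣⊥∣≡0 n)))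

∣S∩[A∪B]∣≤ : ∀ {n} (S A B : Subset n) → ∣ S ∩ (A ∪ B) ∣ ≤ ∣ S ∩ A ∣ + ∣ S ∩ B ∣
∣S∩[A∪B]∣≤ S A B =
  subst (λ U → ∣ U ∣ ≤ ∣ S ∩ A ∣ + ∣ S ∩ B ∣) (sym (∩-distribˡ-∪ S A B))
        (∣p∪q∣≤∣p∣+∣q∣ (S ∩ A) (S ∩ B))

∣S∩[A∪B]∣-disjoint : ∀ {n} (S A B : Subset n) → A ∩ B ⊆ ⊥ →
                     ∣ S ∩ (A ∪ B) ∣ ≡ ∣ S ∩ A ∣ + ∣ S ∩ B ∣
∣S∩[A∪B]∣-disjoint S A B disjoint =
  trans (cong ∣_∣ (∩-distribˡ-∪ S A B)) (∣p∪q∣-disjoint (S ∩ A) (S ∩ B) (λ x∈ → disjoint (into-A∩B x∈)))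
  where
  into-A∩B : (S ∩ A) ∩ (S ∩ B) ⊆ A ∩ B
  into-A∩B x∈ with x∈p∩q⁻ (S ∩ A) (S ∩ B) x∈
  ... | x∈SA , x∈SB = x∈p∩q⁺ (p∩q⊆q S A x∈SA , p∩q⊆q S B x∈SB)

k-subset : ∀ {n} k (p : Subset n) → k ≤ ∣ p ∣ → ∃[ T ] (T ⊆ p × ∣ T ∣ ≡ k)
k-subset {n} zero p _ = ⊥ , ⊥⊆ , ∣⊥∣≡0 n
k-subset (suc k) (outside ∷ p) k<∣p∣ with k-subset (suc k) p k<∣p∣
... | T , T⊆p , ∣T∣≡k = outside ∷ T , out⊆ T⊆p , ∣T∣≡k
k-subset (suc k) (inside ∷ p) (s≤s k≤∣p∣) with k-subset k p k≤∣p∣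
... | T , T⊆p , ∣T∣≡k = inside ∷ T , in⊆in T⊆p , cong suc ∣T∣≡k

cover-meets : ∀ {v k t m} {Y : Subset v} {𝒞 : Coll v} → IsCover Y k t m 𝒞 →
              (S : Subset v) → m ≤ ∣ S ∩ Y ∣ → ∃[ B ] (𝒞 B × t ≤ ∣ S ∩ B ∣)
cover-meets {m = m} {Y} (_ , covers) S m≤∣S∩Y∣ with k-subset m (S ∩ Y) m≤∣S∩Y∣
... | T , T⊆S∩Y , ∣T∣≡m with covers T (λ x∈T → p∩q⊆q S Y (T⊆S∩Y x∈T)) ∣T∣≡m
... | B , 𝒞B , t≤∣T∩B∣ =
  B , 𝒞B , ≤-trans t≤∣T∩B∣ (p⊆q⇒∣p∣≤∣q∣ T∩B⊆S∩B)
  where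
  T∩B⊆S∩B : T ∩ B ⊆ S ∩ B
  T∩B⊆S∩B x∈ with x∈p∩q⁻ T B x∈
  ... | x∈T , x∈B = x∈p∩q⁺ (p∩q⊆p S Y (T⊆S∩Y x∈T) , x∈B)

complete-meets : ∀ {v h k} {Y : Subset v} {𝒞 : Fin h → Coll v} →
                 (∀ T → (∃[ j ] 𝒞 j T) ⇔ (T ⊆ Y × ∣ T ∣ ≡ k)) →
                 (S : Subset v) → k ≤ ∣ S ∩ Y ∣ → ∃[ j ] ∃[ T ] (𝒞 j T × k ≤ ∣ S ∩ T ∣)
complete-meets {k = k} {Y} complete S k≤∣S∩Y∣ with k-subset k (S ∩ Y) k≤∣S∩Y∣
... | T , T⊆S∩Y , ∣T∣≡k
  with Equivalence.from (complete T) ((λ x∈T → p∩q⊆q S Y (T⊆S∩Y x∈T)) , ∣T∣≡k)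
... | j , 𝒞jT = j , T , 𝒞jT , ≤-trans (≤-reflexive (sym ∣T∣≡k)) (p⊆q⇒∣p∣≤∣q∣ T⊆S∩T)
  where
  T⊆S∩T : T ⊆ S ∩ T
  T⊆S∩T x∈T = x∈p∩q⁺ (p∩q⊆p S Y (T⊆S∩Y x∈T) , x∈T)

next-≢ : ∀ i → next4 i ≢ i
next-≢ zero ()
next-≢ (suc zero) ()
next-≢ (suc (suc zero)) ()
next-≢ (suc (suc (suc zero))) ()

next²-≢ : ∀ i → next4 (next4 i) ≢ i
next²-≢ zero ()
next²-≢ (suc zero) ()
next²-≢ (suc (suc zero)) ()
next²-≢ (suc (suc (suc zero))) ()

next³-≢ : ∀ i → next4 (next4 (next4 i)) ≢ i
next³-≢ zero ()
next³-≢ (suc zero) ()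
next³-≢ (suc (suc zero)) ()
next³-≢ (suc (suc (suc zero))) ()

-- The ordered pairs of parts (a , b) for which 𝒞 contains the products
-- 𝒜_{a,j} ℬ_{b,j}: the cyclic pairs (i , i+1) and the pairs (0,2), (1,3).
data Linked : Fin 4 → Fin 4 → Set where
  cyclic : ∀ i → Linked i (next4 i)
  across : ∀ k → Linked (low k) (plus2 k)

low-≢ : ∀ k → low k ≢ plus2 k
low-≢ zero ()
low-≢ (suc zero) ()

linked-distinct : ∀ {a b} → Linked a b → a ≢ b
linked-distinct (cyclic i) i≡next = next-≢ i (sym i≡next)
linked-distinct (across k) = low-≢ k

linked-either : ∀ {a b} → a ≢ b → Linked a b ⊎ Linked b a
linked-either {zero}                {zero}                a≢b = contradiction refl a≢b
linked-either {zero}                {suc zero}            _   = inj₁ (cyclic zero)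
linked-either {zero}                {suc (suc zero)}      _   = inj₁ (across zero)
linked-either {zero}                {suc (suc (suc zero))} _  = inj₂ (cyclic (suc (suc (suc zero))))
linked-either {suc zero}            {zero}                _   = inj₂ (cyclic zero)
linked-either {suc zero}            {suc zero}            a≢b = contradiction refl a≢b
linked-either {suc zero}            {suc (suc zero)}      _   = inj₁ (cyclic (suc zero))
linked-either {suc zero}            {suc (suc (suc zero))} _  = inj₁ (across (suc zero))
linked-either {suc (suc zero)}      {zero}                _   = inj₂ (across zero)
linked-either {suc (suc zero)}      {suc zero}            _   = inj₂ (cyclic (suc zero))
linked-either {suc (suc zero)}      {suc (suc zero)}      a≢b = contradiction refl a≢b
linked-either {suc (suc zero)}      {suc (suc (suc zero))} _  = inj₁ (cyclic (suc (suc zero)))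
linked-either {suc (suc (suc zero))} {zero}               _   = inj₁ (cyclic (suc (suc (suc zero))))
linked-either {suc (suc (suc zero))} {suc zero}           _   = inj₂ (across (suc zero))
linked-either {suc (suc (suc zero))} {suc (suc zero)}     _   = inj₂ (cyclic (suc (suc zero)))
linked-either {suc (suc (suc zero))} {suc (suc (suc zero))} a≢b = contradiction refl a≢b

-- S meets the parts of a product 𝒜_{a,j} ℬ_{b,j} richly enough when it has
-- (at least) 2 + 2 or 3 + 1 points on X_a and X_b respectively.
data Rich (x y : ℕ) : Set where
  two-two   : 2 ≤ x → 2 ≤ y → Rich x y
  three-one : 3 ≤ x → 1 ≤ y → Rich x y

-- A way to find a block meeting S in 4 points, given the profile c.
data Strategy (c : Fin 4 → ℕ) : Set where
  via𝒟       : ∀ k → 5 ≤ c (low k) → Strategy c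
  viaℰ       : ∀ k → 4 ≤ c (plus2 k) → Strategy c
  via-product : ∀ {a b} → Linked a b → Rich (c a) (c b) → Strategy c

total : (Fin 4 → ℕ) → ℕ
total c = c zero + (c (suc zero) + (c (suc (suc zero)) + c (suc (suc (suc zero)))))

total-rotate : ∀ c → total c ≡ total (λ i → c (next4 i))
total-rotate c = begin
  c₀ + (c₁ + (c₂ + c₃))  ≡⟨ +-comm c₀ _ ⟩
  (c₁ + (c₂ + c₃)) + c₀  ≡⟨ +-assoc c₁ (c₂ + c₃) c₀ ⟩
  c₁ + ((c₂ + c₃) + c₀)  ≡⟨ cong (c₁ +_) (+-assoc c₂ c₃ c₀) ⟩
  c₁ + (c₂ + (c₃ + c₀))  ∎
  where
  open ≡-Reasoning
  c₀ = c zero; c₁ = c (suc zero); c₂ = c (suc (suc zero)); c₃ = c (suc (suc (suc zero)))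

total-from : ∀ c i → total c ≡ c i + (c (next4 i) + (c (next4 (next4 i)) + c (next4 (next4 (next4 i)))))
total-from c zero = refl
total-from c (suc zero) = total-rotate c
total-from c (suc (suc zero)) = trans (total-rotate c) (total-rotate (λ i → c (next4 i)))
total-from c (suc (suc (suc zero))) =
  trans (total-rotate c) (trans (total-rotate (λ i → c (next4 i))) (total-rotate (λ i → c (next4 (next4 i)))))

lower-bound : ∀ {k x m} n → k + n ≤ x + m → m ≤ n → k ≤ x
lower-bound {k} {x} {m} n k+n≤x+m m≤n = +-cancelʳ-≤ n k x (≤-trans k+n≤x+m (+-monoʳ-≤ x m≤n))

data LargePart (x p q : ℕ) : Set where
  with-next   : 3 ≤ x → 1 ≤ p → LargePart x p q
  with-second : 4 ≤ x → 1 ≤ q → LargePart x p q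
  alone       : 5 ≤ x → LargePart x p q

large-part : ∀ {x p q r} → p ≤ 1 → q ≤ 1 → r ≤ 1 → 6 ≤ x + (p + (q + r)) → LargePart x p q
large-part (s≤s z≤n) q≤1 r≤1 six = with-next (lower-bound 3 six (s≤s (+-mono-≤ q≤1 r≤1))) (s≤s z≤n)
large-part z≤n (s≤s z≤n) r≤1 six = with-second (lower-bound 2 six (s≤s r≤1)) (s≤s z≤n)
large-part z≤n z≤n r≤1 six = alone (lower-bound 1 six r≤1)

-- If X_i carries
-- a family 𝒟_k it has a second partner X_{plus2 k} and may fall back on 𝒟_k;
-- if it carries ℰ_k, four points already suffice.
low-large-part : ∀ c k →
  LargePart (c (low k)) (c (next4 (low k))) (c (plus2 k)) → Strategy c
low-large-part c k (with-next 3≤x 1≤p)   = via-product (cyclic (low k)) (three-one 3≤x 1≤p)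
low-large-part c k (with-second 4≤x 1≤q) =
  via-product (across k) (three-one (≤-trans (n≤1+n 3) 4≤x) 1≤q)
low-large-part c k (alone 5≤x)           = via𝒟 k 5≤x

high-large-part : ∀ c k q → LargePart (c (plus2 k)) (c (next4 (plus2 k))) q → Strategy c
high-large-part c k q (with-next 3≤x 1≤p) = via-product (cyclic (plus2 k)) (three-one 3≤x 1≤p)
high-large-part c k q (with-second 4≤x _) = viaℰ k 4≤x
high-large-part c k q (alone 5≤x)         = viaℰ k (≤-trans (n≤1+n 4) 5≤x)

large-part-strategy : ∀ c i →
  LargePart (c i) (c (next4 i)) (c (next4 (next4 i))) → Strategy c
large-part-strategy c zero                   = low-large-part c zero
large-part-strategy c (suc zero)             = low-large-part c (suc zero)
large-part-strategy c (suc (suc zero))       = high-large-part c zero _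
large-part-strategy c (suc (suc (suc zero))) = high-large-part c (suc zero) _

two-large-parts : ∀ c {a b} → a ≢ b → 2 ≤ c a → 2 ≤ c b → Strategy c
two-large-parts c a≢b 2≤ca 2≤cb with linked-either a≢b
... | inj₁ a-b = via-product a-b (two-two 2≤ca 2≤cb)
... | inj₂ b-a = via-product b-a (two-two 2≤cb 2≤ca)

one-large-part : ∀ c i → (∀ j → j ≢ i → c j ≤ 1) → 6 ≤ total c → Strategy c
one-large-part c i small six =
  large-part-strategy c i
    (large-part (small _ (next-≢ i)) (small _ (next²-≢ i)) (small _ (next³-≢ i))
                (subst (6 ≤_) (total-from c i) six))

<2⇒≤1 : ∀ {n} → ¬ 2 ≤ n → n ≤ 1
<2⇒≤1 ¬2≤n = ≤-pred (≰⇒> ¬2≤n)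

-- Every profile of total at least six admits a strategy: either two parts
-- hold two points each, or all parts but (at most) one hold at most one.
strategy : ∀ c → 6 ≤ total c → Strategy c
strategy c six with any? (λ i → 2 ≤? c i)
... | no none = one-large-part c zero (λ j _ → <2⇒≤1 (λ 2≤cj → none (j , 2≤cj))) six
... | yes (i , 2≤ci) with any? (λ j → ¬? (j ≟ i) ×-dec (2 ≤? c j))
...   | yes (j , j≢i , 2≤cj) = two-large-parts c j≢i 2≤cj 2≤ci
...   | no none = one-large-part c i (λ j j≢i → <2⇒≤1 (λ 2≤cj → none (j , j≢i , 2≤cj))) six

module Partition {v : ℕ} (X : Fin 4 → Subset v) (partition : IsPartition4 X) where

  parts-disjoint : ∀ {a b} {U W : Subset v} → a ≢ b → U ⊆ X a → W ⊆ X b → U ∩ W ⊆ ⊥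
  parts-disjoint {a} {b} {U} {W} a≢b U⊆Xa W⊆Xb x∈ with x∈p∩q⁻ U W x∈
  ... | x∈U , x∈W = subst (_ ∈_) (proj₁ partition a b a≢b) (x∈p∩q⁺ (U⊆Xa x∈U , W⊆Xb x∈W))

  profile : Subset v → Fin 4 → ℕ
  profile S i = ∣ S ∩ X i ∣

  ∣S∣≤total-profile : ∀ S → ∣ S ∣ ≤ total (profile S)
  ∣S∣≤total-profile S = begin
    ∣ S ∣                               ≡⟨ cong ∣_∣ (sym (∩-identityʳ S)) ⟩
    ∣ S ∩ ⊤ ∣                           ≡⟨ cong (λ U → ∣ S ∩ U ∣) (sym (proj₂ partition)) ⟩
    ∣ S ∩ (X₀ ∪ X₁ ∪ X₂ ∪ X₃) ∣         ≤⟨ ∣S∩[A∪B]∣≤ S X₀ _ ⟩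
    c₀ + ∣ S ∩ (X₁ ∪ X₂ ∪ X₃) ∣         ≤⟨ +-monoʳ-≤ c₀ (∣S∩[A∪B]∣≤ S X₁ _) ⟩
    c₀ + (c₁ + ∣ S ∩ (X₂ ∪ X₃) ∣)       ≤⟨ +-monoʳ-≤ c₀ (+-monoʳ-≤ c₁ (∣S∩[A∪B]∣≤ S X₂ X₃)) ⟩
    c₀ + (c₁ + (c₂ + c₃))               ∎
    where
    open ≤-Reasoning
    X₀ = X zero; X₁ = X (suc zero); X₂ = X (suc (suc zero)); X₃ = X (suc (suc (suc zero)))
    c₀ = profile S zero; c₁ = profile S (suc zero)
    c₂ = profile S (suc (suc zero)); c₃ = profile S (suc (suc (suc zero)))

module Construction {v h : ℕ} (X : Fin 4 → Subset v) (partition : IsPartition4 X)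
    (𝒜 ℬ : Fin 4 → Fin h → Coll v)
    (𝒜-design : ∀ i j → IsCoveringDesign (X i) 3 2 (𝒜 i j))
    (ℬ-design : ∀ i j → IsCoveringDesign (X i) 2 1 (ℬ i j))
    (𝒜-complete : ∀ i (S : Subset v) → (∃[ j ] 𝒜 i j S) ⇔ (S ⊆ X i × ∣ S ∣ ≡ 3))
    (ℬ-complete : ∀ i (S : Subset v) → (∃[ j ] ℬ i j S) ⇔ (S ⊆ X i × ∣ S ∣ ≡ 2))
    (𝒟 ℰ : Fin 2 → Coll v)
    (𝒟-cover : ∀ i → IsCover (X (low i)) 5 4 5 (𝒟 i))
    (ℰ-design : ∀ i → IsCoveringDesign (X (plus2 i)) 5 4 (ℰ i)) where

  open Partition X partition

  𝒞 : Coll v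
  𝒞 = buildC 𝒜 ℬ 𝒟 ℰ

  𝒜⊆X : ∀ {i j A} → 𝒜 i j A → A ⊆ X i
  𝒜⊆X {i} {j} {A} 𝒜A = proj₁ (proj₁ (𝒜-design i j) A 𝒜A)

  ℬ⊆X : ∀ {i j B} → ℬ i j B → B ⊆ X i
  ℬ⊆X {i} {j} {B} ℬB = proj₁ (proj₁ (ℬ-design i j) B ℬB)

  product⊆𝒞 : ∀ {a b j C} → Linked a b → (𝒜 a j ⊗ ℬ b j) C → 𝒞 C
  product⊆𝒞 (cyclic i) AB = inj₂ (inj₁ (i , _ , AB))
  product⊆𝒞 (across k) AB = inj₂ (inj₂ (k , _ , AB))

  product-size : ∀ {a b j C} → a ≢ b → (𝒜 a j ⊗ ℬ b j) C → ∣ C ∣ ≡ 5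
  product-size {a} {b} {j} a≢b (A , B , 𝒜A , ℬB , refl) =
    trans (∣p∪q∣-disjoint A B (parts-disjoint a≢b (𝒜⊆X 𝒜A) (ℬ⊆X ℬB)))
          (cong₂ _+_ (proj₂ (proj₁ (𝒜-design a j) A 𝒜A)) (proj₂ (proj₁ (ℬ-design b j) B ℬB)))

  𝒞-blocks : ∀ B → 𝒞 B → B ⊆ ⊤ × ∣ B ∣ ≡ 5
  𝒞-blocks B (inj₁ (i , inj₁ 𝒟B))         = ⊆⊤ , proj₂ (proj₁ (𝒟-cover i) B 𝒟B)
  𝒞-blocks B (inj₁ (i , inj₂ ℰB))         = ⊆⊤ , proj₂ (proj₁ (ℰ-design i) B ℰB)
  𝒞-blocks B (inj₂ (inj₁ (i , _ , AB)))   = ⊆⊤ , product-size (linked-distinct (cyclic i)) AB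
  𝒞-blocks B (inj₂ (inj₂ (k , _ , AB)))   = ⊆⊤ , product-size (low-≢ k) AB

  product-meets : ∀ {a b j A B m n} (S : Subset v) → Linked a b → 𝒜 a j A → ℬ b j B →
                  m ≤ ∣ S ∩ A ∣ → n ≤ ∣ S ∩ B ∣ → ∃[ C ] (𝒞 C × m + n ≤ ∣ S ∩ C ∣)
  product-meets {A = A} {B} S ab 𝒜A ℬB m≤ n≤ =
    A ∪ B , product⊆𝒞 ab (A , B , 𝒜A , ℬB , refl) ,
    ≤-trans (+-mono-≤ m≤ n≤)
      (≤-reflexive (sym (∣S∩[A∪B]∣-disjoint S A B
        (parts-disjoint (linked-distinct ab) (𝒜⊆X 𝒜A) (ℬ⊆X ℬB)))))

  -- A rich pair of linked parts is served by a product block: the points of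
  -- S in one part form a block of some ℬ_{b,j} (resp. 𝒜_{a,j}), and the
  -- covering design 𝒜_{a,j} (resp. ℬ_{b,j}) with the same j catches the rest.
  rich-meets : ∀ {a b} (S : Subset v) → Linked a b → Rich (profile S a) (profile S b) →
               ∃[ C ] (𝒞 C × 4 ≤ ∣ S ∩ C ∣)
  rich-meets {a} {b} S ab (two-two 2≤Sa 2≤Sb)
    with complete-meets (ℬ-complete b) S 2≤Sb
  ... | j , B , ℬB , 2≤∣S∩B∣ with cover-meets (𝒜-design a j) S 2≤Sa
  ... | A , 𝒜A , 2≤∣S∩A∣ = product-meets S ab 𝒜A ℬB 2≤∣S∩A∣ 2≤∣S∩B∣
  rich-meets {a} {b} S ab (three-one 3≤Sa 1≤Sb)
    with complete-meets (𝒜-complete a) S 3≤Sa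
  ... | j , A , 𝒜A , 3≤∣S∩A∣ with cover-meets (ℬ-design b j) S 1≤Sb
  ... | B , ℬB , 1≤∣S∩B∣ = product-meets S ab 𝒜A ℬB 3≤∣S∩A∣ 1≤∣S∩B∣

  realise : ∀ S → Strategy (profile S) → ∃[ B ] (𝒞 B × 4 ≤ ∣ S ∩ B ∣)
  realise S (via𝒟 k 5≤Sk) with cover-meets (𝒟-cover k) S 5≤Sk
  ... | B , 𝒟B , 4≤ = B , inj₁ (k , inj₁ 𝒟B) , 4≤
  realise S (viaℰ k 4≤Sk) with cover-meets (ℰ-design k) S 4≤Sk
  ... | B , ℰB , 4≤ = B , inj₁ (k , inj₂ ℰB) , 4≤
  realise S (via-product ab rich) = rich-meets S ab rich

  𝒞-cover : IsCover ⊤ 5 4 6 𝒞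
  𝒞-cover = 𝒞-blocks , λ S _ ∣S∣≡6 →
    realise S (strategy (profile S) (subst (_≤ total (profile S)) ∣S∣≡6 (∣S∣≤total-profile S)))

theorem20 : (v h : ℕ) → 0 < h →
    (X : Fin 4 → Subset v) → IsPartition4 X →
    (∀ i j → ∣ X i ∣ ≤ suc ∣ X j ∣) →
    (𝒜 ℬ : Fin 4 → Fin h → Coll v) →
    (∀ i j → IsCoveringDesign (X i) 3 2 (𝒜 i j)) →
    (∀ i j → IsCoveringDesign (X i) 2 1 (ℬ i j)) →
    (∀ i (S : Subset v) → (∃[ j ] 𝒜 i j S) ⇔ (S ⊆ X i × ∣ S ∣ ≡ 3)) →
    (∀ i (S : Subset v) → (∃[ j ] ℬ i j S) ⇔ (S ⊆ X i × ∣ S ∣ ≡ 2)) →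
    (𝒟 ℰ : Fin 2 → Coll v) →
    (∀ i → IsCover (X (low i)) 5 4 5 (𝒟 i)) →
    (∀ i → IsCoveringDesign (X (plus2 i)) 5 4 (ℰ i)) →
    IsCover ⊤ 5 4 6 (buildC 𝒜 ℬ 𝒟 ℰ)
theorem20 v h _ X partition _ 𝒜 ℬ 𝒜-design ℬ-design 𝒜-complete ℬ-complete 𝒟 ℰ 𝒟-cover ℰ-design =
  Construction.𝒞-cover X partition 𝒜 ℬ 𝒜-design ℬ-design 𝒜-complete ℬ-complete 𝒟 ℰ 𝒟-cover ℰ-design
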